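{- Let $G$ be a graph with $n$ vertices and vertices $s,t$ to which Rule 1 no longer applies, let $F$ be a feedback vertex set of $G$ (computed by a 2-approximation algorithm), and let $\mathcal{C}_F$ be the set of entry-exit cycles $(C,s',t')$ of $G$ with $|V(C)\cap F|\le 2$. Then $|\mathcal{C}_F|=O(n^8)$.
   Context: All graphs are finite, undirected and simple; paths do not repeat vertices. Rule 1: remove any edge or vertex lying on no $s$-$t$ path. A feedback vertex set is a vertex set whose removal leaves an acyclic graph. An entry-exit cycle is a triple $(C,s',t')$ with $C$ a cycle and $s',t'\in V(C)$ such that there exist vertex-disjoint paths $s$-$s'$ and $t'$-$t$ meeting $C$ only in $s'$ and $t'$ respectively. -}

module Defs where

open import Data.Nat using (ℕ; _≤_; _*_)
open import Data.Fin using (Fin)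
open import Data.Fin.Subset using (Subset; ∣_∣) renaming (_∈_ to _∈ˢ_)
open import Data.Fin.Subset.Properties using () renaming (_∈?_ to _∈ˢ?_)
open import Data.List using (List; []; _∷_; _++_; [_]; length; last; filter; take)
open import Data.List.Membership.Propositional using (_∈_)
open import Data.List.Relation.Unary.Unique.Propositional using (Unique)
open import Data.List.Relation.Unary.Linked using (Linked)
open import Data.Maybe using (just)
open import Data.Product using (Σ; _×_; ∃; ∃₂; _,_)
open import Data.Sum using (_⊎_)
open import Relation.Binary.PropositionalEquality using (_≡_)
open import Data.Empty using (⊥)
open import Relation.Nullary using (¬_)
open import Function.Bundles using (_⇔_)

record Graph (n : ℕ) : Set₁ where
  field
    Adj   : Fin n → Fin n → Set
    sym   : ∀ {u v} → Adj u v → Adj v u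
    irrefl : ∀ {u} → ¬ Adj u u
open Graph public

module _ {n : ℕ} (G : Graph n) where

  IsPath : List (Fin n) → Set
  IsPath xs = Unique xs × Linked (Adj G) xs

  PathFromTo : Fin n → Fin n → List (Fin n) → Set
  PathFromTo a b xs = IsPath xs × (∃ λ ys → xs ≡ a ∷ ys) × last xs ≡ just b

  IsCycle : List (Fin n) → Set
  IsCycle vs = 3 ≤ length vs × IsPath vs ×
    (∃₂ λ a z → (∃ λ ws → vs ≡ a ∷ ws) × last vs ≡ just z × Adj G z a)

  Consec : List (Fin n) → Fin n → Fin n → Set
  Consec xs u v = ∃₂ λ ps qs → xs ≡ ps ++ u ∷ v ∷ qs

  CycEdge : List (Fin n) → Fin n → Fin n → Set
  CycEdge vs u v = Consec (vs ++ take 1 vs) u v ⊎ Consec (vs ++ take 1 vs) v u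

  -- Two cyclic sequences describe the same cycle (same edge set, hence
  -- same subgraph): identification up to rotation / reflection.
  SameCycle : List (Fin n) → List (Fin n) → Set
  SameCycle vs ws = ∀ u v → CycEdge vs u v ⇔ CycEdge ws u v

  -- Rule 1 does not apply: every vertex and every edge lies on an s-t path.
  Rule1Exhausted : Fin n → Fin n → Set
  Rule1Exhausted s t =
    (∀ v → ∃ λ P → PathFromTo s t P × v ∈ P) ×
    (∀ u v → Adj G u v → ∃ λ P → PathFromTo s t P × (Consec P u v ⊎ Consec P v u))

  IsFVS : Subset n → Set
  IsFVS F = ∀ vs → IsCycle vs → ∃ λ v → v ∈ vs × v ∈ˢ F

  -- F is a 2-approximate (hence computable by a 2-approximation) FVS.
  Is2ApproxFVS : Subset n → Set
  Is2ApproxFVS F = IsFVS F × (∀ F′ → IsFVS F′ → ∣ F ∣ ≤ 2 * ∣ F′ ∣)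

  Triple : Set
  Triple = List (Fin n) × Fin n × Fin n

  IsEntryExit : Fin n → Fin n → Triple → Set
  IsEntryExit s t (C , s′ , t′) = IsCycle C × s′ ∈ C × t′ ∈ C ×
    (∃₂ λ P Q → PathFromTo s s′ P × PathFromTo t′ t Q ×
       (∀ v → v ∈ P → v ∈ Q → ⊥) ×
       (∀ v → v ∈ P → v ∈ C → v ≡ s′) ×
       (∀ v → v ∈ Q → v ∈ C → v ≡ t′))

  -- |V(C) ∩ F| (C has distinct vertices, so this counts V(C) ∩ F).
  FCount : Subset n → List (Fin n) → ℕ
  FCount F C = length (filter (_∈ˢ? F) C)

  SameTriple : Triple → Triple → Set
  SameTriple (C , a , b) (D , c , d) = SameCycle C D × a ≡ c × b ≡ d

-- A cycle meeting the feedback vertex set F in at most two vertices is pinned down by six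
-- vertices. Rotate it to start at a vertex f ∈ F; the remaining vertices split at the other
-- F-vertex g, if there is one, into at most two arcs of the forest G − F. Two different paths
-- of G − F with the same ends would close a cycle avoiding F, so each arc is determined by its
-- first and last vertex. With the entry and exit vertices s′ and t′ this gives an injective
-- code of the entry-exit cycles in question into eight-tuples of vertices.
module Submission where

open import Defs
open import Data.Nat using (ℕ; suc; _≤_; _+_; _*_; _^_; z≤n; s≤s; s≤s⁻¹)
open import Data.Nat.Properties using (+-comm; *-identityˡ; ≤⇒≯)
open import Data.Fin using (Fin; funToFin; finToFun) renaming (zero to 0F; suc to sucF; _≟_ to _≟ᶠ_)
open import Data.Fin.Properties using (injective⇒≤; finToFun-funToFin)
open import Data.Fin.Subset using (Subset) renaming (_∈_ to _∈ˢ_; _∉_ to _∉ˢ_)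
open import Data.Fin.Subset.Properties using () renaming (_∈?_ to _∈ˢ?_)
open import Data.List using (List; []; _∷_; _++_; _∷ʳ_; [_]; length; reverse; take; last; filter; lookup)
open import Data.List.Properties
  using ( ∷-injectiveʳ; ++-assoc; ++-identityʳ; reverse-++; unfold-reverse; reverse-involutive
        ; length-++; length-reverse; filter-accept; filter-some)
open import Data.List.Membership.Propositional using (_∈_; _∉_)
open import Data.List.Membership.Propositional.Properties
  using (∈-∃++; ∈-lookup; ∈-++⁺ˡ; ∈-++⁺ʳ; ∈-++⁻)
import Data.List.Membership.DecPropositional as DecMembership
open import Data.List.Relation.Unary.Any using (here; there)
open import Data.List.Relation.Unary.All as All using (All; []; _∷_)
open import Data.List.Relation.Unary.All.Properties
  using (¬Any⇒All¬; ++⁻ˡ; ++⁻ʳ) renaming (++⁺ to All-++⁺)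
open import Data.List.Relation.Unary.AllPairs using (AllPairs; []; _∷_)
open import Data.List.Relation.Unary.Linked using (Linked; []; [-]; _∷_)
open import Data.List.Relation.Unary.Unique.Propositional using (Unique)
import Data.List.Relation.Unary.Unique.Propositional.Properties as Unique
open import Data.List.Relation.Binary.Disjoint.Propositional using (Disjoint)
open import Data.List.Relation.Binary.Permutation.Propositional using (_↭_; prep; ↭-sym; ↭-trans; ↭⇒↭ₛ)
open import Data.List.Relation.Binary.Permutation.Propositional.Properties
  using (↭-reverse; ↭-length; ++⁺ˡ; shift; All-resp-↭; filter-↭) renaming (++-comm to ↭-++-comm)
import Data.List.Relation.Binary.Permutation.Setoid.Properties as Permutationₛ
open import Data.Maybe using (just)
open import Data.Maybe.Properties using (just-injective)
open import Data.Vec as Vec using (Vec; tabulate)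
open import Data.Vec.Properties using (tabulate∘lookup; tabulate-cong)
open import Data.Product using (_×_; ∃; ∃₂; _,_; proj₁; proj₂)
open import Data.Sum as Sum using (_⊎_; inj₁; inj₂)
open import Data.Empty using (⊥-elim)
open import Function using (_∘_)
open import Function.Bundles using (_⇔_; mk⇔; Equivalence)
import Function.Properties.Equivalence as ⇔
open import Function.Definitions using (Injective)
open import Relation.Nullary using (¬_; yes; no; contradiction)
open import Relation.Unary using (Decidable; ∁)
open import Relation.Binary.Definitions using (DecidableEquality)
open import Relation.Binary.PropositionalEquality as ≡
  using (_≡_; _≢_; refl; trans; cong; cong₂; subst; setoid; _≗_; module ≡-Reasoning)

module _ {A : Set} where

  Consecutive : List A → A → A → Set
  Consecutive xs u v = ∃₂ λ ps qs → xs ≡ ps ++ u ∷ v ∷ qs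

  consecutive-here : ∀ {u v qs} → Consecutive (u ∷ v ∷ qs) u v
  consecutive-here {qs = qs} = [] , qs , refl

  consecutive-∷⁺ : ∀ {x xs u v} → Consecutive xs u v → Consecutive (x ∷ xs) u v
  consecutive-∷⁺ {x} (ps , qs , refl) = x ∷ ps , qs , refl

  consecutive-∷⁻ : ∀ {x y ys u v} → Consecutive (x ∷ y ∷ ys) u v →
                   (u ≡ x × v ≡ y) ⊎ Consecutive (y ∷ ys) u v
  consecutive-∷⁻ ([] , _ , refl) = inj₁ (refl , refl)
  consecutive-∷⁻ (_ ∷ ps , qs , eq) = inj₂ (ps , qs , ∷-injectiveʳ eq)

  ¬consecutive-[] : ∀ {u v} → ¬ Consecutive [] u v
  ¬consecutive-[] ([] , _ , ())
  ¬consecutive-[] (_ ∷ _ , _ , ())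

  ¬consecutive-[-] : ∀ {x u v} → ¬ Consecutive [ x ] u v
  ¬consecutive-[-] ([] , _ , ())
  ¬consecutive-[-] (_ ∷ [] , _ , ())
  ¬consecutive-[-] (_ ∷ _ ∷ _ , _ , ())

  consecutive-++⁺ˡ : ∀ {xs} ys {u v} → Consecutive xs u v → Consecutive (xs ++ ys) u v
  consecutive-++⁺ˡ ys {u} {v} (ps , qs , refl) = ps , qs ++ ys , ++-assoc ps (u ∷ v ∷ qs) ys

  consecutive-++⁺ʳ : ∀ xs {ys u v} → Consecutive ys u v → Consecutive (xs ++ ys) u v
  consecutive-++⁺ʳ xs {u = u} {v} (ps , qs , refl) = xs ++ ps , qs , ≡.sym (++-assoc xs ps (u ∷ v ∷ qs))

  consecutive-++⁻ : ∀ xs {y ys u v} → Consecutive (xs ++ y ∷ ys) u v →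
                    Consecutive (xs ∷ʳ y) u v ⊎ Consecutive (y ∷ ys) u v
  consecutive-++⁻ [] c = inj₂ c
  consecutive-++⁻ (x ∷ []) c with consecutive-∷⁻ c
  ... | inj₁ (refl , refl) = inj₁ consecutive-here
  ... | inj₂ c′ = inj₂ c′
  consecutive-++⁻ (x ∷ x′ ∷ xs) c =
    Sum.[ (λ { (refl , refl) → inj₁ consecutive-here })
        , Sum.map₁ consecutive-∷⁺ ∘ consecutive-++⁻ (x′ ∷ xs)
        ] (consecutive-∷⁻ c)

  consecutive-reverse⁺ : ∀ {xs u v} → Consecutive xs u v → Consecutive (reverse xs) v u
  consecutive-reverse⁺ {u = u} {v} (ps , qs , refl) = reverse qs , reverse ps , (begin
    reverse (ps ++ u ∷ v ∷ qs)                ≡⟨ reverse-++ ps (u ∷ v ∷ qs) ⟩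
    reverse (u ∷ v ∷ qs) ++ reverse ps        ≡⟨ cong (_++ reverse ps) (reverse-++ (u ∷ v ∷ []) qs) ⟩
    (reverse qs ++ v ∷ u ∷ []) ++ reverse ps  ≡⟨ ++-assoc (reverse qs) (v ∷ u ∷ []) (reverse ps) ⟩
    reverse qs ++ v ∷ u ∷ reverse ps          ∎)
    where open ≡-Reasoning

  lastOr : A → List A → A
  lastOr x [] = x
  lastOr x (y ∷ ys) = lastOr y ys

  headOr : A → List A → A
  headOr x [] = x
  headOr x (y ∷ _) = y

  ends : A → List A → A × A
  ends x xs = headOr x xs , lastOr x xs

  lastOr-∈ : ∀ x xs → lastOr x xs ∈ x ∷ xs
  lastOr-∈ x [] = here refl
  lastOr-∈ x (y ∷ ys) = there (lastOr-∈ y ys)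

  lastOr-++ : ∀ x xs y ys → lastOr x (xs ++ y ∷ ys) ≡ lastOr y ys
  lastOr-++ x [] y ys = refl
  lastOr-++ x (x′ ∷ xs) y ys = lastOr-++ x′ xs y ys

  last≡lastOr : ∀ x xs → last (x ∷ xs) ≡ just (lastOr x xs)
  last≡lastOr x [] = refl
  last≡lastOr x (y ∷ ys) = last≡lastOr y ys

  consecutive-lastOr : ∀ x xs y → Consecutive (x ∷ xs ∷ʳ y) (lastOr x xs) y
  consecutive-lastOr x [] y = consecutive-here
  consecutive-lastOr x (x′ ∷ xs) y = consecutive-∷⁺ (consecutive-lastOr x′ xs y)

  consecutive-∷ʳ⁻ : ∀ x xs {y u v} → Consecutive (x ∷ xs ∷ʳ y) u v →
                    Consecutive (x ∷ xs) u v ⊎ (u ≡ lastOr x xs × v ≡ y)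
  consecutive-∷ʳ⁻ x [] c with consecutive-∷⁻ c
  ... | inj₁ eqs = inj₂ eqs
  ... | inj₂ c′ = ⊥-elim (¬consecutive-[-] c′)
  consecutive-∷ʳ⁻ x (x′ ∷ xs) c with consecutive-∷⁻ c
  ... | inj₁ (refl , refl) = inj₁ consecutive-here
  ... | inj₂ c′ = Sum.map₁ consecutive-∷⁺ (consecutive-∷ʳ⁻ x′ xs c′)

  ClosedConsecutive : List A → A → A → Set
  ClosedConsecutive xs = Consecutive (xs ++ take 1 xs)

  infix 4 _≋_
  record _≋_ (xs ys : List A) : Set where
    constructor mk≋
    field closed-pairs : ∀ {u v} → ClosedConsecutive xs u v ⇔ ClosedConsecutive ys u v
  open _≋_ public

  ≋-reflexive : ∀ {xs ys} → xs ≡ ys → xs ≋ ys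
  ≋-reflexive refl = mk≋ ⇔.refl

  ≋-sym : ∀ {xs ys} → xs ≋ ys → ys ≋ xs
  ≋-sym (mk≋ xs⇔ys) = mk≋ (⇔.sym xs⇔ys)

  ≋-trans : ∀ {xs ys zs} → xs ≋ ys → ys ≋ zs → xs ≋ zs
  ≋-trans (mk≋ xs⇔ys) (mk≋ ys⇔zs) = mk≋ (⇔.trans xs⇔ys ys⇔zs)

  rotate₁-≋ : ∀ x xs → x ∷ xs ≋ xs ∷ʳ x
  rotate₁-≋ x [] = ≋-reflexive refl
  rotate₁-≋ x (y ∷ ys) = mk≋ (mk⇔ to from)
    where
    to : ∀ {u v} → ClosedConsecutive (x ∷ y ∷ ys) u v → ClosedConsecutive (y ∷ ys ∷ʳ x) u v
    to c with consecutive-∷⁻ c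
    ... | inj₁ (refl , refl) =
          subst (λ z → Consecutive (y ∷ ys ∷ʳ x ∷ʳ y) z y) (lastOr-++ y ys x [])
                (consecutive-lastOr y (ys ∷ʳ x) y)
    ... | inj₂ c′ = consecutive-++⁺ˡ [ y ] c′
    from : ∀ {u v} → ClosedConsecutive (y ∷ ys ∷ʳ x) u v → ClosedConsecutive (x ∷ y ∷ ys) u v
    from c with consecutive-∷ʳ⁻ y (ys ∷ʳ x) c
    ... | inj₁ c′ = consecutive-∷⁺ c′
    ... | inj₂ (refl , refl) rewrite lastOr-++ y ys x [] = consecutive-here

  rotate-≋ : ∀ ps f qs → ps ++ f ∷ qs ≋ f ∷ qs ++ ps
  rotate-≋ [] f qs = ≋-reflexive (cong (f ∷_) (≡.sym (++-identityʳ qs)))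
  rotate-≋ (p ∷ ps) f qs =
    ≋-trans (rotate₁-≋ p (ps ++ f ∷ qs)) (
    ≋-trans (≋-reflexive (++-assoc ps (f ∷ qs) [ p ])) (
    ≋-trans (rotate-≋ ps f (qs ∷ʳ p))
            (≋-reflexive (cong (f ∷_) (++-assoc qs [ p ] ps)))))

  Unique-++⁻ : ∀ (xs : List A) {ys} → Unique (xs ++ ys) → Unique xs × Unique ys × Disjoint xs ys
  Unique-++⁻ [] ys! = [] , ys! , λ ()
  Unique-++⁻ (x ∷ xs) (x∉ ∷ xsys!) with Unique-++⁻ xs xsys!
  ... | xs! , ys! , disjoint = All.tabulate (All.lookup x∉ ∘ ∈-++⁺ˡ) ∷ xs! , ys! , λ where
    (here refl , x∈ys) → All.lookup x∉ (∈-++⁺ʳ xs x∈ys) refl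
    (there v∈xs , v∈ys) → disjoint (v∈xs , v∈ys)

  Unique-resp-↭ : ∀ {xs ys} → xs ↭ ys → Unique xs → Unique ys
  Unique-resp-↭ p = Permutationₛ.Unique-resp-↭ (setoid A) (↭⇒↭ₛ p)

  module _ (_≟_ : DecidableEquality A) where
    open DecMembership _≟_ using (_∈?_)

    split-at-first-∈ : ∀ {z} xs ys → z ∈ xs → z ∈ ys →
              ∃₂ λ X w → ∃ λ X′ → xs ≡ X ++ w ∷ X′ × w ∈ ys × All (_∉ ys) X
    split-at-first-∈ (x ∷ xs) ys z∈ z∈ys with x ∈? ys
    ... | yes x∈ys = [] , x , xs , refl , x∈ys , []
    ... | no x∉ys with z∈
    ...   | here refl = contradiction z∈ys x∉ys
    ...   | there z∈xs with split-at-first-∈ xs ys z∈xs z∈ys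
    ...     | X , w , X′ , refl , w∈ys , X∉ys = x ∷ X , w , X′ , refl , w∈ys , x∉ys ∷ X∉ys

module _ {A : Set} {P : A → Set} (P? : Decidable P) where

  split-at-unique : ∀ xs → length (filter P? xs) ≤ 1 →
    All (∁ P) xs ⊎ ∃₂ λ xs₁ y → ∃ λ xs₂ →
      xs ≡ xs₁ ++ y ∷ xs₂ × P y × All (∁ P) xs₁ × All (∁ P) xs₂
  split-at-unique [] _ = inj₁ []
  split-at-unique (x ∷ xs) h with P? x
  ... | yes px with h
  ...   | s≤s h′ =
    inj₂ ([] , x , xs , refl , px , [] , ¬Any⇒All¬ xs (λ p → ≤⇒≯ h′ (filter-some P? p)))
  split-at-unique (x ∷ xs) h | no ¬px with split-at-unique xs h
  ... | inj₁ none = inj₁ (¬px ∷ none)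
  ... | inj₂ (xs₁ , y , xs₂ , refl , py , ¬P₁ , ¬P₂) =
    inj₂ (x ∷ xs₁ , y , xs₂ , refl , py , ¬px ∷ ¬P₁ , ¬P₂)

Unique-lookup-injective : ∀ {A : Set} {xs : List A} → Unique xs → Injective _≡_ _≡_ (lookup xs)
Unique-lookup-injective (x∉ ∷ xs!) {0F} {0F} _ = refl
Unique-lookup-injective (x∉ ∷ xs!) {0F} {sucF j} eq = contradiction eq (All.lookup x∉ (∈-lookup j))
Unique-lookup-injective (x∉ ∷ xs!) {sucF i} {0F} eq = contradiction (≡.sym eq) (All.lookup x∉ (∈-lookup i))
Unique-lookup-injective (x∉ ∷ xs!) {sucF i} {sucF j} eq = cong sucF (Unique-lookup-injective xs! eq)

Unique⇒length≤ : ∀ {N} {xs : List (Fin N)} → Unique xs → length xs ≤ N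
Unique⇒length≤ xs! = injective⇒≤ (Unique-lookup-injective xs!)

module _ {A : Set} {P : A → Set} {_≈_ : A → A → Set} {N : ℕ}
         (code : ∀ {x} → P x → Fin N)
         (code-injective : ∀ {x y} (px : P x) (py : P y) → code px ≡ code py → x ≈ y) where

  private
    codes : ∀ {xs} → All P xs → List (Fin N)
    codes = All.reduce code

    length-codes : ∀ {xs} (pxs : All P xs) → length (codes pxs) ≡ length xs
    length-codes [] = refl
    length-codes (_ ∷ pxs) = cong suc (length-codes pxs)

    codes-fresh : ∀ {x ys} (px : P x) (pys : All P ys) →
                  All (λ y → ¬ x ≈ y) ys → All (code px ≢_) (codes pys)
    codes-fresh px [] [] = []
    codes-fresh px (py ∷ pys) (x≉y ∷ x≉ys) = (x≉y ∘ code-injective px py) ∷ codes-fresh px pys x≉ys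

    codes-unique : ∀ {xs} (pxs : All P xs) → AllPairs (λ x y → ¬ x ≈ y) xs → Unique (codes pxs)
    codes-unique [] [] = []
    codes-unique (px ∷ pxs) (x≉xs ∷ distinct) = codes-fresh px pxs x≉xs ∷ codes-unique pxs distinct

  length≤-of-code : ∀ {xs} → All P xs → AllPairs (λ x y → ¬ x ≈ y) xs → length xs ≤ N
  length≤-of-code pxs distinct =
    subst (_≤ N) (length-codes pxs) (Unique⇒length≤ (codes-unique pxs distinct))

funToFin-lookup-injective : ∀ {k n} {u v : Vec (Fin n) k} →
                            funToFin (Vec.lookup u) ≡ funToFin (Vec.lookup v) → u ≡ v
funToFin-lookup-injective {u = u} {v} eq = begin
  u                     ≡⟨ tabulate∘lookup u ⟨
  tabulate (Vec.lookup u) ≡⟨ tabulate-cong lookup-u≗v ⟩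
  tabulate (Vec.lookup v) ≡⟨ tabulate∘lookup v ⟩
  v                     ∎
  where
  open ≡-Reasoning
  lookup-u≗v : Vec.lookup u ≗ Vec.lookup v
  lookup-u≗v i = trans (≡.sym (finToFun-funToFin (Vec.lookup u) i))
                  (trans (cong (λ c → finToFun c i) eq) (finToFun-funToFin (Vec.lookup v) i))

module _ {A : Set} where

  flatten : (A × A × (A × A) × (A × A)) × A × A → Vec A 8
  flatten ((f , g , (a₁ , b₁) , (a₂ , b₂)) , s′ , t′) =
    Vec.fromList (f ∷ g ∷ a₁ ∷ b₁ ∷ a₂ ∷ b₂ ∷ s′ ∷ t′ ∷ [])

  flatten-injective : ∀ {c d} → flatten c ≡ flatten d → c ≡ d
  flatten-injective {(_ , _ , (_ , _) , (_ , _)) , _ , _} {(_ , _ , (_ , _) , (_ , _)) , _ , _} refl = refl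

module _ {n : ℕ} (G : Graph n) where

  IsWalk : List (Fin n) → Set
  IsWalk xs = ∀ {u v} → Consecutive xs u v → Adj G u v

  Linked⇒IsWalk : ∀ {xs} → Linked (Adj G) xs → IsWalk xs
  Linked⇒IsWalk [] c = ⊥-elim (¬consecutive-[] c)
  Linked⇒IsWalk [-] c = ⊥-elim (¬consecutive-[-] c)
  Linked⇒IsWalk (uv ∷ walk) c with consecutive-∷⁻ c
  ... | inj₁ (refl , refl) = uv
  ... | inj₂ c′ = Linked⇒IsWalk walk c′

  IsWalk⇒Linked : ∀ {xs} → IsWalk xs → Linked (Adj G) xs
  IsWalk⇒Linked {[]} _ = []
  IsWalk⇒Linked {_ ∷ []} _ = [-]
  IsWalk⇒Linked {_ ∷ _ ∷ _} walk = walk consecutive-here ∷ IsWalk⇒Linked (walk ∘ consecutive-∷⁺)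

  IsWalk-++⁻ˡ : ∀ xs {ys} → IsWalk (xs ++ ys) → IsWalk xs
  IsWalk-++⁻ˡ xs {ys} walk = walk ∘ consecutive-++⁺ˡ ys

  IsWalk-++⁻ʳ : ∀ xs {ys} → IsWalk (xs ++ ys) → IsWalk ys
  IsWalk-++⁻ʳ xs walk = walk ∘ consecutive-++⁺ʳ xs

  IsWalk-join : ∀ xs {y ys} → IsWalk (xs ∷ʳ y) → IsWalk (y ∷ ys) → IsWalk (xs ++ y ∷ ys)
  IsWalk-join xs walk₁ walk₂ = Sum.[ walk₁ , walk₂ ] ∘ consecutive-++⁻ xs

  IsWalk-reverse : ∀ {xs} → IsWalk xs → IsWalk (reverse xs)
  IsWalk-reverse {xs} walk c =
    Graph.sym G (walk (subst (λ zs → Consecutive zs _ _) (reverse-involutive xs) (consecutive-reverse⁺ c)))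

  ≋⇒SameCycle : ∀ {C D} → C ≋ D → SameCycle G C D
  ≋⇒SameCycle (mk≋ C⇔D) u v =
    mk⇔ (Sum.map (Equivalence.to C⇔D) (Equivalence.to C⇔D))
        (Sum.map (Equivalence.from C⇔D) (Equivalence.from C⇔D))

  IsCycle⇒IsWalk-closed : ∀ {C} → IsCycle G C → IsWalk (C ++ take 1 C)
  IsCycle⇒IsWalk-closed (_ , (_ , linked) , a , z , (ws , refl) , last≡z , za) c
    with consecutive-∷ʳ⁻ a ws c
  ... | inj₁ c′ = Linked⇒IsWalk linked c′
  ... | inj₂ (refl , refl) =
    subst (λ z′ → Adj G z′ a) (just-injective (trans (≡.sym last≡z) (last≡lastOr a ws))) za

  IsCycle-intro : ∀ {a ws} → 3 ≤ length (a ∷ ws) → Unique (a ∷ ws) → IsWalk (a ∷ ws ∷ʳ a) →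
                  IsCycle G (a ∷ ws)
  IsCycle-intro {a} {ws} long unique closed =
    long , (unique , IsWalk⇒Linked (IsWalk-++⁻ˡ (a ∷ ws) closed)) ,
    a , lastOr a ws , (ws , refl) , last≡lastOr a ws , closed (consecutive-lastOr a ws a)

  length-cycle-of-two-paths : ∀ (a w : Fin n) X Y →
    length ((a ∷ X ∷ʳ w) ++ reverse Y) ≡ 2 + (length X + length Y)
  length-cycle-of-two-paths a w X Y = begin
    length ((a ∷ X ∷ʳ w) ++ reverse Y)        ≡⟨ length-++ (a ∷ X ∷ʳ w) ⟩
    suc (length (X ∷ʳ w)) + length (reverse Y)
      ≡⟨ cong₂ (λ p q → suc p + q) (length-++ X) (length-reverse Y) ⟩
    suc (length X + 1) + length Y             ≡⟨ cong (λ p → suc p + length Y) (+-comm (length X) 1) ⟩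
    2 + (length X + length Y)                 ∎
    where open ≡-Reasoning

  cycle-of-two-paths : ∀ {a w} X Y → Unique (a ∷ X ∷ʳ w) → IsWalk (a ∷ X ∷ʳ w) →
    Unique (a ∷ Y ∷ʳ w) → IsWalk (a ∷ Y ∷ʳ w) → Disjoint X Y → 1 ≤ length X + length Y →
    IsCycle G ((a ∷ X ∷ʳ w) ++ reverse Y)
  cycle-of-two-paths {a} {w} X Y unique₁ walk₁ unique₂@(a∉Yw ∷ Yw!) walk₂ X∩Y=∅ X+Y≥1 =
    IsCycle-intro long unique closed
    where
    long : 3 ≤ length ((a ∷ X ∷ʳ w) ++ reverse Y)
    long = subst (3 ≤_) (≡.sym (length-cycle-of-two-paths a w X Y)) (s≤s (s≤s X+Y≥1))

    Y! : Unique Y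
    Y! = proj₁ (Unique-++⁻ Y Yw!)

    w∉Y : w ∉ Y
    w∉Y w∈Y = proj₂ (proj₂ (Unique-++⁻ Y Yw!)) (w∈Y , here refl)

    path₁∩Y=∅ : Disjoint (a ∷ X ∷ʳ w) Y
    path₁∩Y=∅ (here refl , a∈Y) = All.lookup a∉Yw (∈-++⁺ˡ a∈Y) refl
    path₁∩Y=∅ (there v∈Xw , v∈Y) with ∈-++⁻ X v∈Xw
    ... | inj₁ v∈X = X∩Y=∅ (v∈X , v∈Y)
    ... | inj₂ (here refl) = w∉Y v∈Y

    unique : Unique ((a ∷ X ∷ʳ w) ++ reverse Y)
    unique = Unique-resp-↭ (↭-sym (++⁺ˡ (a ∷ X ∷ʳ w) (↭-reverse Y)))
                           (Unique.++⁺ unique₁ Y! path₁∩Y=∅)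

    closing : ((a ∷ X ∷ʳ w) ++ reverse Y) ∷ʳ a ≡ (a ∷ X) ++ w ∷ reverse (a ∷ Y)
    closing = cong (a ∷_) (begin
      ((X ∷ʳ w) ++ reverse Y) ∷ʳ a  ≡⟨ ++-assoc (X ∷ʳ w) (reverse Y) [ a ] ⟩
      (X ∷ʳ w) ++ (reverse Y ∷ʳ a)  ≡⟨ ++-assoc X [ w ] (reverse Y ∷ʳ a) ⟩
      X ++ w ∷ (reverse Y ∷ʳ a)     ≡⟨ cong (λ zs → X ++ w ∷ zs) (unfold-reverse a Y) ⟨
      X ++ w ∷ reverse (a ∷ Y)      ∎)
      where open ≡-Reasoning

    closed : IsWalk (((a ∷ X ∷ʳ w) ++ reverse Y) ∷ʳ a)
    closed = subst IsWalk (≡.sym closing)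
      (IsWalk-join (a ∷ X) walk₁ (subst IsWalk (reverse-++ (a ∷ Y) [ w ]) (IsWalk-reverse walk₂)))

module _ {n : ℕ} (G : Graph n) (F : Subset n) where

  IsFreePath : List (Fin n) → Set
  IsFreePath xs = Unique xs × IsWalk G xs × All (_∉ˢ F) xs

  IsFreePath-++⁻ : ∀ xs {ys} → IsFreePath (xs ++ ys) → IsFreePath xs × IsFreePath ys
  IsFreePath-++⁻ xs (unique , walk , free) with Unique-++⁻ xs unique
  ... | xs! , ys! , _ = (xs! , IsWalk-++⁻ˡ G xs walk , ++⁻ˡ xs free)
                      , (ys! , IsWalk-++⁻ʳ G xs walk , ++⁻ʳ xs free)

  IsFreePath-prefix : ∀ {a} X {w X′} → IsFreePath (a ∷ X ++ w ∷ X′) → IsFreePath (a ∷ X ∷ʳ w)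
  IsFreePath-prefix {a} X {w} {X′} p =
    proj₁ (IsFreePath-++⁻ (a ∷ X ∷ʳ w)
             (subst IsFreePath (cong (a ∷_) (≡.sym (++-assoc X [ w ] X′))) p))

  data Arcs (f : Fin n) : List (Fin n) → Set where
    one-arc  : ∀ {R} → IsFreePath R → Arcs f R
    two-arcs : ∀ {R₁ R₂} g → g ∈ˢ F → g ≢ f → IsFreePath R₁ → IsFreePath R₂ →
               Arcs f (R₁ ++ g ∷ R₂)

  arcs : ∀ {f} R → Unique (f ∷ R) → IsWalk G (f ∷ R) → length (filter (_∈ˢ? F) R) ≤ 1 → Arcs f R
  arcs R (f∉R ∷ R!) walk ≤1 with split-at-unique (_∈ˢ? F) R ≤1
  ... | inj₁ free = one-arc (R! , IsWalk-++⁻ʳ G [ _ ] walk , free)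
  ... | inj₂ (R₁ , g , R₂ , refl , g∈F , free₁ , free₂) with Unique-++⁻ R₁ R!
  ...   | R₁! , _ ∷ R₂! , _ =
    two-arcs g g∈F (All.lookup f∉R (∈-++⁺ʳ R₁ (here refl)) ∘ ≡.sym)
      (R₁! , IsWalk-++⁻ˡ G R₁ walk-R , free₁)
      (R₂! , IsWalk-++⁻ʳ G [ g ] (IsWalk-++⁻ʳ G R₁ walk-R) , free₂)
    where
    walk-R : IsWalk G (R₁ ++ g ∷ R₂)
    walk-R = IsWalk-++⁻ʳ G [ _ ] walk

  -- A missing second F-vertex and an empty arc are both coded by f, which no arc vertex equals.
  arcsCode : ∀ {f R} → Arcs f R → Fin n × (Fin n × Fin n) × (Fin n × Fin n)
  arcsCode {f} {R} (one-arc _) = f , ends f R , ends f []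
  arcsCode {f} (two-arcs {R₁} {R₂} g _ _ _ _) = g , ends f R₁ , ends f R₂

  module _ (F-meets-cycles : IsFVS G F) where

    no-diverging-free-paths : ∀ {a x y P Q} → x ≢ y →
      IsFreePath (a ∷ x ∷ P) → IsFreePath (a ∷ y ∷ Q) → lastOr x P ≢ lastOr y Q
    -- The first vertex w of x ∷ P on y ∷ Q closes the cycle a ⋯ w ⋯ y a, which avoids F.
    no-diverging-free-paths {a} {x} {y} {P} {Q} x≢y p q same-end
      with split-at-first-∈ _≟ᶠ_ (x ∷ P) (y ∷ Q) (lastOr-∈ x P)
             (subst (_∈ y ∷ Q) (≡.sym same-end) (lastOr-∈ y Q))
    ... | X , w , X′ , eqX , w∈yQ , X∉yQ with ∈-∃++ w∈yQ
    ...   | Y , Y′ , eqY = cycle-avoids-F (F-meets-cycles _ cycle)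
      where
      path₁ : IsFreePath (a ∷ X ∷ʳ w)
      path₁ = IsFreePath-prefix X (subst IsFreePath (cong (a ∷_) eqX) p)
      path₂ : IsFreePath (a ∷ Y ∷ʳ w)
      path₂ = IsFreePath-prefix Y (subst IsFreePath (cong (a ∷_) eqY) q)

      X∩Y=∅ : Disjoint X Y
      X∩Y=∅ (v∈X , v∈Y) = All.lookup X∉yQ v∈X (subst (_ ∈_) (≡.sym eqY) (∈-++⁺ˡ v∈Y))

      prefixes-nonempty : ∀ X X′ Y Y′ → x ∷ P ≡ X ++ w ∷ X′ → y ∷ Q ≡ Y ++ w ∷ Y′ →
                          1 ≤ length X + length Y
      prefixes-nonempty [] _ [] _ refl refl = contradiction refl x≢y
      prefixes-nonempty (_ ∷ _) _ _ _ _ _ = s≤s z≤n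
      prefixes-nonempty [] _ (_ ∷ _) _ _ _ = s≤s z≤n

      cycle : IsCycle G ((a ∷ X ∷ʳ w) ++ reverse Y)
      cycle = cycle-of-two-paths G X Y
                (proj₁ path₁) (proj₁ (proj₂ path₁)) (proj₁ path₂) (proj₁ (proj₂ path₂)) X∩Y=∅
                (prefixes-nonempty X X′ Y Y′ eqX eqY)

      cycle-free : All (_∉ˢ F) ((a ∷ X ∷ʳ w) ++ reverse Y)
      cycle-free = All-resp-↭ (↭-sym (++⁺ˡ (a ∷ X ∷ʳ w) (↭-reverse Y)))
        (All-++⁺ (proj₂ (proj₂ path₁)) (++⁻ˡ Y (All.tail (proj₂ (proj₂ path₂)))))

      cycle-avoids-F : ¬ ∃ λ v → v ∈ (a ∷ X ∷ʳ w) ++ reverse Y × v ∈ˢ F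
      cycle-avoids-F (v , v∈cycle , v∈F) = All.lookup cycle-free v∈cycle v∈F

    free-path-unique : ∀ {a} P Q → IsFreePath (a ∷ P) → IsFreePath (a ∷ Q) →
                       lastOr a P ≡ lastOr a Q → P ≡ Q
    free-path-unique [] [] _ _ _ = refl
    free-path-unique [] (y ∷ Q) _ (a∉ ∷ _ , _) a≡end =
      contradiction a≡end (All.lookup a∉ (lastOr-∈ y Q))
    free-path-unique (x ∷ P) [] (a∉ ∷ _ , _) _ end≡a =
      contradiction (≡.sym end≡a) (All.lookup a∉ (lastOr-∈ x P))
    free-path-unique {a} (x ∷ P) (y ∷ Q) p q same-end with x ≟ᶠ y
    ... | yes refl = cong (x ∷_) (free-path-unique P Q (tail p) (tail q) same-end)
      where
      tail : ∀ {xs} → IsFreePath (a ∷ xs) → IsFreePath xs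
      tail = proj₂ ∘ IsFreePath-++⁻ [ a ]
    ... | no x≢y = contradiction same-end (no-diverging-free-paths x≢y p q)

    ends-injective : ∀ {f} → f ∈ˢ F → ∀ xs ys → IsFreePath xs → IsFreePath ys →
                     ends f xs ≡ ends f ys → xs ≡ ys
    ends-injective f∈F [] [] _ _ _ = refl
    ends-injective f∈F [] (y ∷ _) _ (_ , _ , y∉F ∷ _) eq =
      contradiction (subst (_∈ˢ F) (cong proj₁ eq) f∈F) y∉F
    ends-injective f∈F (x ∷ _) [] (_ , _ , x∉F ∷ _) _ eq =
      contradiction (subst (_∈ˢ F) (≡.sym (cong proj₁ eq)) f∈F) x∉F
    ends-injective f∈F (x ∷ xs) (y ∷ ys) p q eq with cong proj₁ eq
    ... | refl = cong (x ∷_) (free-path-unique xs ys p q (cong proj₂ eq))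

    arcsCode-injective : ∀ {f R S} → f ∈ˢ F → (α : Arcs f R) (β : Arcs f S) →
                         arcsCode α ≡ arcsCode β → R ≡ S
    arcsCode-injective f∈F (one-arc p) (one-arc q) eq = ends-injective f∈F _ _ p q (cong (proj₁ ∘ proj₂) eq)
    arcsCode-injective f∈F (one-arc _) (two-arcs g _ g≢f _ _) eq = contradiction (≡.sym (cong proj₁ eq)) g≢f
    arcsCode-injective f∈F (two-arcs g _ g≢f _ _) (one-arc _) eq = contradiction (cong proj₁ eq) g≢f
    arcsCode-injective f∈F (two-arcs g _ _ p₁ p₂) (two-arcs _ _ _ q₁ q₂) eq with cong proj₁ eq
    ... | refl = cong₂ (λ R₁ R₂ → R₁ ++ g ∷ R₂)
                   (ends-injective f∈F _ _ p₁ q₁ (cong (proj₁ ∘ proj₂) eq))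
                   (ends-injective f∈F _ _ p₂ q₂ (cong (proj₂ ∘ proj₂) eq))

    Anchoring : List (Fin n) → Set
    Anchoring C = ∃₂ λ f R → f ∈ˢ F × C ≋ f ∷ R × Arcs f R

    anchor : ∀ {C} → IsCycle G C → FCount G F C ≤ 2 → Anchoring C
    anchor {C} cycle ≤2 with F-meets-cycles C cycle
    ... | f , f∈C , f∈F with ∈-∃++ f∈C
    ...   | ps , qs , refl = f , qs ++ ps , f∈F , rotate-≋ ps f qs , arcs (qs ++ ps) unique walk ≤1
      where
      rotation : ps ++ f ∷ qs ↭ f ∷ qs ++ ps
      rotation = ↭-trans (shift f ps qs) (prep f (↭-++-comm ps qs))

      unique : Unique (f ∷ qs ++ ps)
      unique = Unique-resp-↭ rotation (proj₁ (proj₁ (proj₂ cycle)))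

      walk : IsWalk G (f ∷ qs ++ ps)
      walk = IsCycle⇒IsWalk-closed G cycle
           ∘ Equivalence.from (closed-pairs (rotate-≋ ps f qs))
           ∘ consecutive-++⁺ˡ [ f ]

      count : FCount G F C ≡ suc (length (filter (_∈ˢ? F) (qs ++ ps)))
      count = trans (↭-length (filter-↭ (_∈ˢ? F) rotation)) (cong length (filter-accept (_∈ˢ? F) f∈F))

      ≤1 : length (filter (_∈ˢ? F) (qs ++ ps)) ≤ 1
      ≤1 = s≤s⁻¹ (subst (_≤ 2) count ≤2)

    anchorCode : ∀ {C} → Anchoring C → Fin n × Fin n × (Fin n × Fin n) × (Fin n × Fin n)
    anchorCode (f , _ , _ , _ , α) = f , arcsCode α

    anchorCode-injective : ∀ {C D} (a : Anchoring C) (b : Anchoring D) → anchorCode a ≡ anchorCode b → C ≋ D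
    anchorCode-injective (f , R , f∈F , C≋fR , α) (_ , S , _ , D≋fS , β) eq with cong proj₁ eq
    ... | refl = ≋-trans C≋fR (≋-trans (≋-reflexive (cong (f ∷_) R≡S)) (≋-sym D≋fS))
      where
      R≡S : R ≡ S
      R≡S = arcsCode-injective f∈F α β (cong proj₂ eq)

    module _ {s t : Fin n} where

      entryExitCode : ∀ {T} → IsEntryExit G s t T × FCount G F (proj₁ T) ≤ 2 → Fin (n ^ 8)
      entryExitCode {C , s′ , t′} (entry-exit , ≤2) =
        funToFin (Vec.lookup (flatten (anchorCode (anchor (proj₁ entry-exit) ≤2) , s′ , t′)))

      entryExitCode-injective : ∀ {T U} (p : IsEntryExit G s t T × FCount G F (proj₁ T) ≤ 2)
        (q : IsEntryExit G s t U × FCount G F (proj₁ U) ≤ 2) →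
        entryExitCode p ≡ entryExitCode q → SameTriple G T U
      entryExitCode-injective {C , s₁ , t₁} {D , s₂ , t₂} (entry-exit₁ , ≤2₁) (entry-exit₂ , ≤2₂) eq =
        ≋⇒SameCycle G (anchorCode-injective anchor₁ anchor₂ (cong proj₁ codes≡)) ,
        cong (proj₁ ∘ proj₂) codes≡ , cong (proj₂ ∘ proj₂) codes≡
        where
        anchor₁ : Anchoring C
        anchor₁ = anchor (proj₁ entry-exit₁) ≤2₁
        anchor₂ : Anchoring D
        anchor₂ = anchor (proj₁ entry-exit₂) ≤2₂
        codes≡ : (anchorCode anchor₁ , s₁ , t₁) ≡ (anchorCode anchor₂ , s₂ , t₂)
        codes≡ = flatten-injective (funToFin-lookup-injective eq)

lemma13 : ∃ λ (c : ℕ) → ∀ (n : ℕ) (G : Graph n) (s t : Fin n) →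
    Rule1Exhausted G s t → (F : Subset n) → Is2ApproxFVS G F →
    (L : List (Triple G)) →
    All (λ T → IsEntryExit G s t T × FCount G F (proj₁ T) ≤ 2) L →
    AllPairs (λ T U → ¬ SameTriple G T U) L →
    length L ≤ c * n ^ 8
lemma13 = 1 , λ n G s t _ F (F-meets-cycles , _) L entry-exits distinct →
  subst (length L ≤_) (≡.sym (*-identityˡ (n ^ 8)))
    (length≤-of-code (entryExitCode G F F-meets-cycles) (entryExitCode-injective G F F-meets-cycles)
      entry-exits distinct)
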